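{- Let $h(x)$ be a polynomial with real coefficients; let $F_{h,n}(x)$, $L_{h,n}(x)$ be defined by $F_{h,0}=0$, $F_{h,1}=1$, $F_{h,n+1}=h(x)F_{h,n}+F_{h,n-1}$ and $L_{h,0}=2$, $L_{h,1}=h(x)$, $L_{h,n+1}=h(x)L_{h,n}+L_{h,n-1}$ ($n\ge1$); and let $F_{h,n}^l(x)=\sum_{i=0}^{l}\binom{n-1-i}{i}h^{n-2i-1}(x)$ for $n\ge1$, $0\le l\le\lfloor (n-1)/2\rfloor$. Then for every integer $n\ge1$, $$\sum_{l=0}^{\lfloor (n-1)/2\rfloor}F_{h,n}^{l}(x)=\begin{cases}\dfrac{4F_{h,n}(x)+nh(x)L_{h,n}(x)}{2(h^2(x)+4)} & (n\text{ even}),\\[2ex] \dfrac{(h^2(x)+8)F_{h,n}(x)+nh(x)L_{h,n}(x)}{2(h^2(x)+4)} & (n\text{ odd}).\end{cases}$$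
   Context: $h(x)$ is a polynomial with real coefficients; $h^k(x)$ denotes $(h(x))^k$. $F_{h,n}$, $L_{h,n}$ are the $h(x)$-Fibonacci and $h(x)$-Lucas polynomials, and $F_{h,n}^l$ the incomplete $h(x)$-Fibonacci polynomials. -}

module Defs where

open import Algebra.Bundles using (CommutativeRing)
open import Data.Nat as ℕ using (ℕ; zero; suc; _∸_)
open import Data.Nat.Combinatorics using (_C_)

-- All objects are evaluated at a point: h stands for the value h(x),
-- taken in an arbitrary commutative ring R (e.g. ℝ).
module HFib {c ℓ} (R : CommutativeRing c ℓ) where
  open CommutativeRing R

  ι : ℕ → Carrier
  ι zero = 0#
  ι (suc n) = 1# + ι n

  pow : Carrier → ℕ → Carrier
  pow x zero = 1#
  pow x (suc k) = x * pow x k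

  F : Carrier → ℕ → Carrier
  F h zero = 0#
  F h (suc zero) = 1#
  F h (suc (suc n)) = h * F h (suc n) + F h n

  L : Carrier → ℕ → Carrier
  L h zero = 1# + 1#
  L h (suc zero) = h
  L h (suc (suc n)) = h * L h (suc n) + L h n

  sumTo : ℕ → (ℕ → Carrier) → Carrier
  sumTo zero f = f 0
  sumTo (suc m) f = sumTo m f + f (suc m)

  Finc : Carrier → ℕ → ℕ → Carrier
  Finc h n l = sumTo l (λ i → ι ((n ∸ 1 ∸ i) C i) * pow h (n ∸ 2 ℕ.* i ∸ 1))

{-# OPTIONS --safe #-}
-- Write Δ = h² + 4, A n = 4 F n + n h L n and S n = Σ_l F^l_n. Pascal's rule gives the incomplete
-- polynomials the recurrence F^{l+1}_{n+3} = h F^{l+1}_{n+2} + F^l_{n+1}, and F^l_{n+1} = F_{n+1} once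
-- n ≤ 2l. Summing over l, S (n+2) = h S (n+1) + S n, plus h F (n+1) when n is odd: then the recurrence
-- sums F^l_{n+1} up to one index beyond the range of S (n+1), and that extra term is saturated.
-- On the other side Δ F (n+1) = L (n+2) + L n gives A (n+2) = h A (n+1) + A n + h Δ F (n+1), while Δ F
-- obeys the plain recurrence. Hence 2Δ S n = A n for even n and 2Δ S n = A n + Δ F n for odd n, by a
-- joint induction; finally (h² + 8) F = 4 F + Δ F.
module Submission where

open import Defs
open import Algebra.Bundles using (CommutativeRing)
open import Data.Empty using (⊥-elim)
open import Data.Nat as ℕ using (ℕ; zero; suc; _∸_; ⌊_/2⌋; _%_; _≤_; _<_; z≤n; s≤s; _≤?_)
open import Data.Nat.Combinatorics using (_C_; nCn≡1; nCk+nC[k+1]≡[n+1]C[k+1]; k>n⇒nCk≡0)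
open import Data.Nat.DivMod using ([m+kn]%n≡m%n)
open import Data.Nat.Properties as ℕₚ
  using (+-suc; m+n∸m≡n; m<n+o⇒m∸n<o; n≤1+n; m≤n⇒m≤1+n; ≤-trans; ≰⇒>; m≤n⇒∃[o]m+o≡n;
         1+n≢0; 0≢1+n)
open import Data.Product using (_×_; _,_; proj₁; proj₂; ∃-syntax)
open import Data.Sum using (_⊎_; inj₁; inj₂)
open import Relation.Nullary using (yes; no)
open import Relation.Binary.PropositionalEquality as ≡ using (_≡_; cong; cong₂; module ≡-Reasoning)

n*2≡n+n : ∀ n → n ℕ.* 2 ≡ n ℕ.+ n
n*2≡n+n n = ≡.trans (ℕₚ.*-comm n 2) (cong (n ℕ.+_) (ℕₚ.+-identityʳ n))

[n*2+k]∸n≡n+k : ∀ n k → n ℕ.* 2 ℕ.+ k ∸ n ≡ n ℕ.+ k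
[n*2+k]∸n≡n+k n k = begin
  n ℕ.* 2 ℕ.+ k ∸ n   ≡⟨ cong (λ m → m ℕ.+ k ∸ n) (n*2≡n+n n) ⟩
  n ℕ.+ n ℕ.+ k ∸ n   ≡⟨ cong (_∸ n) (ℕₚ.+-assoc n n k) ⟩
  n ℕ.+ (n ℕ.+ k) ∸ n ≡⟨ m+n∸m≡n n (n ℕ.+ k) ⟩
  n ℕ.+ k             ∎
  where open ≡-Reasoning

[1+n*2+k]∸2n∸1≡k : ∀ n k → suc (n ℕ.* 2 ℕ.+ k) ∸ 2 ℕ.* n ∸ 1 ≡ k
[1+n*2+k]∸2n∸1≡k n k = cong (_∸ 1) (begin
  suc (n ℕ.* 2 ℕ.+ k) ∸ 2 ℕ.* n ≡⟨ cong (λ m → suc (m ℕ.+ k) ∸ 2 ℕ.* n) (ℕₚ.*-comm n 2) ⟩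
  suc (2 ℕ.* n ℕ.+ k) ∸ 2 ℕ.* n ≡⟨ cong (_∸ 2 ℕ.* n) (≡.sym (+-suc (2 ℕ.* n) k)) ⟩
  2 ℕ.* n ℕ.+ suc k ∸ 2 ℕ.* n   ≡⟨ m+n∸m≡n (2 ℕ.* n) (suc k) ⟩
  suc k                         ∎)
  where open ≡-Reasoning

⌊n*2/2⌋≡n : ∀ n → ⌊ n ℕ.* 2 /2⌋ ≡ n
⌊n*2/2⌋≡n zero    = ≡.refl
⌊n*2/2⌋≡n (suc n) = cong suc (⌊n*2/2⌋≡n n)

⌊1+n*2/2⌋≡n : ∀ n → ⌊ suc (n ℕ.* 2) /2⌋ ≡ n
⌊1+n*2/2⌋≡n zero    = ≡.refl
⌊1+n*2/2⌋≡n (suc n) = cong suc (⌊1+n*2/2⌋≡n n)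

[1+n*2]%2≡1 : ∀ n → suc (n ℕ.* 2) % 2 ≡ 1
[1+n*2]%2≡1 n = [m+kn]%n≡m%n 1 n 2

[2+n*2]%2≡0 : ∀ n → (2 ℕ.+ n ℕ.* 2) % 2 ≡ 0
[2+n*2]%2≡0 n = [m+kn]%n≡m%n 2 n 2

even-or-odd : ∀ n → (∃[ k ] n ≡ k ℕ.* 2) ⊎ (∃[ k ] n ≡ suc (k ℕ.* 2))
even-or-odd zero = inj₁ (0 , ≡.refl)
even-or-odd (suc n) with even-or-odd n
... | inj₁ (k , ≡.refl) = inj₂ (k , ≡.refl)
... | inj₂ (k , ≡.refl) = inj₁ (suc k , ≡.refl)

module IncompleteFibonacciSums {c ℓ} (R : CommutativeRing c ℓ) (h : CommutativeRing.Carrier R) where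
  open CommutativeRing R
  open HFib R
  open import Algebra.Solver.Ring.NaturalCoefficients.Default commutativeSemiring
  open import Relation.Binary.Reasoning.Setoid setoid

  -- Mirrors ι, so that ιᴾ n denotes ι n definitionally (con n denotes n × 1#).
  ιᴾ : ℕ → ∀ {k} → Polynomial k
  ιᴾ zero    = con 0
  ιᴾ (suc n) = con 1 :+ ιᴾ n

  ι-+ : ∀ m n → ι (m ℕ.+ n) ≈ ι m + ι n
  ι-+ zero    n = sym (+-identityˡ (ι n))
  ι-+ (suc m) n = trans (+-congˡ (ι-+ m n)) (sym (+-assoc 1# (ι m) (ι n)))

  solve-by-inverse : ∀ {w x y z} → w * x ≈ 1# → x * y ≈ z → y ≈ z * w
  solve-by-inverse {w} {x} {y} {z} w*x≈1 x*y≈z = begin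
    y             ≈˘⟨ *-identityʳ y ⟩
    y * 1#        ≈˘⟨ *-congˡ w*x≈1 ⟩
    y * (w * x)   ≈⟨ solve 3 (λ w x y → y :* (w :* x) := (x :* y) :* w) refl w x y ⟩
    (x * y) * w   ≈⟨ *-congʳ x*y≈z ⟩
    z * w         ∎

  sumTo≈head : ∀ m (f : ℕ → Carrier) → (∀ i → f (suc i) ≈ 0#) → sumTo m f ≈ f 0
  sumTo≈head zero    f f≈0 = refl
  sumTo≈head (suc m) f f≈0 = begin
    sumTo m f + f (suc m) ≈⟨ +-cong (sumTo≈head m f f≈0) (f≈0 m) ⟩
    f 0 + 0#              ≈⟨ +-identityʳ (f 0) ⟩
    f 0                   ∎

  sumTo-recurrence : ∀ m a {f g k : ℕ → Carrier} →
    f 0 ≈ a * g 0 → (∀ i → f (suc i) ≈ a * g (suc i) + k i) →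
    sumTo (suc m) f ≈ a * sumTo (suc m) g + sumTo m k
  sumTo-recurrence zero a {f} {g} {k} f₀ fₛ = begin
    f 0 + f 1                   ≈⟨ +-cong f₀ (fₛ 0) ⟩
    a * g 0 + (a * g 1 + k 0)   ≈⟨ solve 4 (λ a x y z → a :* x :+ (a :* y :+ z) := a :* (x :+ y) :+ z)
                                          refl a (g 0) (g 1) (k 0) ⟩
    a * (g 0 + g 1) + k 0       ∎
  sumTo-recurrence (suc m) a {f} {g} {k} f₀ fₛ = begin
    sumTo (suc m) f + f (2 ℕ.+ m)
      ≈⟨ +-cong (sumTo-recurrence m a f₀ fₛ) (fₛ (suc m)) ⟩
    (a * sumTo (suc m) g + sumTo m k) + (a * g (2 ℕ.+ m) + k (suc m))
      ≈⟨ solve 5 (λ a x y z w → (a :* x :+ y) :+ (a :* z :+ w) := a :* (x :+ z) :+ (y :+ w))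
                 refl a (sumTo (suc m) g) (sumTo m k) (g (2 ℕ.+ m)) (k (suc m)) ⟩
    a * sumTo (2 ℕ.+ m) g + sumTo (suc m) k
      ∎

  summand : ℕ → ℕ → Carrier
  summand n i = ι ((n ∸ 1 ∸ i) C i) * pow h (n ∸ 2 ℕ.* i ∸ 1)

  monomial : ℕ → ℕ → Carrier
  monomial i k = ι ((i ℕ.+ k) C i) * pow h k

  summand-zero : ∀ n → summand (suc n) 0 ≈ pow h n
  summand-zero n = trans (*-congʳ (+-identityʳ 1#)) (*-identityˡ (pow h n))

  summand-zero-recurrence : ∀ n → summand (2 ℕ.+ n) 0 ≈ h * summand (suc n) 0
  summand-zero-recurrence n = trans (summand-zero (suc n)) (*-congˡ (sym (summand-zero n)))

  summand-vanishes : ∀ {n} i → n < i ℕ.* 2 → summand (suc n) i ≈ 0#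
  summand-vanishes {n} (suc i) n<i*2 = begin
    ι ((n ∸ suc i) C suc i) * pow h (suc n ∸ 2 ℕ.* suc i ∸ 1)
      ≡⟨ cong (λ b → ι b * pow h (suc n ∸ 2 ℕ.* suc i ∸ 1))
              (k>n⇒nCk≡0 (m<n+o⇒m∸n<o n (suc i) n<i+i)) ⟩
    0# * pow h (suc n ∸ 2 ℕ.* suc i ∸ 1)
      ≈⟨ zeroˡ _ ⟩
    0# ∎
    where
    n<i+i : n < suc i ℕ.+ suc i
    n<i+i = ≡.subst (n <_) (n*2≡n+n (suc i)) n<i*2

  summand≡monomial : ∀ {n} i k → n ≡ i ℕ.* 2 ℕ.+ k → summand (suc n) i ≡ monomial i k
  summand≡monomial i k ≡.refl =
    cong₂ (λ b e → ι (b C i) * pow h e) ([n*2+k]∸n≡n+k i k) ([1+n*2+k]∸2n∸1≡k i k)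

  monomial-diagonal : ∀ i → monomial i 0 ≡ ι 1 * 1#
  monomial-diagonal i = cong (λ b → ι b * 1#) (≡.trans (cong (_C i) (ℕₚ.+-identityʳ i)) (nCn≡1 i))

  monomial-pascal : ∀ i k → monomial (suc i) (suc k) ≈ h * monomial (suc i) k + monomial i (suc k)
  monomial-pascal i k = begin
    ι (suc (i ℕ.+ suc k) C suc i) * (h * pow h k)
      ≡⟨ cong (λ b → ι b * (h * pow h k)) (≡.sym (nCk+nC[k+1]≡[n+1]C[k+1] (i ℕ.+ suc k) i)) ⟩
    ι (a ℕ.+ b) * (h * pow h k)
      ≈⟨ *-congʳ (ι-+ a b) ⟩
    (ι a + ι b) * (h * pow h k)
      ≈⟨ solve 4 (λ x y h p → (x :+ y) :* (h :* p) := h :* (y :* p) :+ x :* (h :* p))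
               refl (ι a) (ι b) h (pow h k) ⟩
    h * (ι b * pow h k) + ι a * (h * pow h k)
      ≡⟨ cong (λ m → h * (ι (m C suc i) * pow h k) + ι a * (h * pow h k)) (+-suc i k) ⟩
    h * monomial (suc i) k + monomial i (suc k) ∎
    where
    a b : ℕ
    a = (i ℕ.+ suc k) C i
    b = (i ℕ.+ suc k) C suc i

  summand-pascal : ∀ n j →
    summand (3 ℕ.+ n) (suc j) ≈ h * summand (2 ℕ.+ n) (suc j) + summand (suc n) j
  summand-pascal n j with j ℕ.* 2 ≤? n
  ... | no j*2≰n = begin
    summand (3 ℕ.+ n) (suc j)
      ≈⟨ summand-vanishes (suc j) (s≤s (s≤s n<j*2)) ⟩
    0#
      ≈⟨ solve 1 (λ h → con 0 := h :* con 0 :+ con 0) refl h ⟩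
    h * 0# + 0#
      ≈˘⟨ +-cong (*-congˡ (summand-vanishes (suc j) (s≤s (m≤n⇒m≤1+n n<j*2))))
                 (summand-vanishes j n<j*2) ⟩
    h * summand (2 ℕ.+ n) (suc j) + summand (suc n) j ∎
    where
    n<j*2 : n < j ℕ.* 2
    n<j*2 = ≰⇒> j*2≰n
  ... | yes j*2≤n with m≤n⇒∃[o]m+o≡n j*2≤n
  ...   | zero , ≡.refl = begin
    summand (3 ℕ.+ (j ℕ.* 2 ℕ.+ 0)) (suc j)
      ≡⟨ summand≡monomial (suc j) 0 ≡.refl ⟩
    monomial (suc j) 0
      ≡⟨ ≡.trans (monomial-diagonal (suc j)) (≡.sym (monomial-diagonal j)) ⟩
    monomial j 0
      ≡˘⟨ summand≡monomial j 0 ≡.refl ⟩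
    summand (suc (j ℕ.* 2 ℕ.+ 0)) j
      ≈⟨ solve 2 (λ h s → s := h :* con 0 :+ s) refl h _ ⟩
    h * 0# + summand (suc (j ℕ.* 2 ℕ.+ 0)) j
      ≈˘⟨ +-congʳ (*-congˡ (summand-vanishes (suc j) on-boundary)) ⟩
    h * summand (2 ℕ.+ (j ℕ.* 2 ℕ.+ 0)) (suc j) + summand (suc (j ℕ.* 2 ℕ.+ 0)) j ∎
    where
    on-boundary : suc (j ℕ.* 2 ℕ.+ 0) < suc j ℕ.* 2
    on-boundary = s≤s (s≤s (ℕₚ.≤-reflexive (ℕₚ.+-identityʳ (j ℕ.* 2))))
  ...   | suc k , ≡.refl = begin
    summand (3 ℕ.+ (j ℕ.* 2 ℕ.+ suc k)) (suc j)
      ≡⟨ summand≡monomial (suc j) (suc k) ≡.refl ⟩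
    monomial (suc j) (suc k)
      ≈⟨ monomial-pascal j k ⟩
    h * monomial (suc j) k + monomial j (suc k)
      ≡˘⟨ cong₂ (λ x y → h * x + y) (summand≡monomial (suc j) k (cong suc (+-suc (j ℕ.* 2) k)))
                                   (summand≡monomial j (suc k) ≡.refl) ⟩
    h * summand (2 ℕ.+ (j ℕ.* 2 ℕ.+ suc k)) (suc j) + summand (suc (j ℕ.* 2 ℕ.+ suc k)) j ∎

  Finc-recurrence : ∀ n l → Finc h (3 ℕ.+ n) (suc l) ≈ h * Finc h (2 ℕ.+ n) (suc l) + Finc h (suc n) l
  Finc-recurrence n l = sumTo-recurrence l h (summand-zero-recurrence (suc n)) (summand-pascal n)

  Finc-saturates : ∀ n l → n ≤ l ℕ.* 2 → Finc h (suc n) l ≈ F h (suc n)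
  Finc-saturates zero l _ =
    trans (sumTo≈head l (summand 1) (λ i → summand-vanishes (suc i) (s≤s z≤n))) (summand-zero 0)
  Finc-saturates (suc zero) l _ =
    trans (sumTo≈head l (summand 2) (λ i → summand-vanishes (suc i) (s≤s (s≤s z≤n))))
          (trans (summand-zero 1) (sym (+-identityʳ (h * 1#))))
  Finc-saturates (suc (suc n)) (suc l) n≤l*2 = begin
    Finc h (3 ℕ.+ n) (suc l)
      ≈⟨ Finc-recurrence n l ⟩
    h * Finc h (2 ℕ.+ n) (suc l) + Finc h (suc n) l
      ≈⟨ +-cong (*-congˡ (Finc-saturates (suc n) (suc l) (≤-trans (n≤1+n _) n≤l*2)))
                (Finc-saturates n l (ℕ.s≤s⁻¹ (ℕ.s≤s⁻¹ n≤l*2))) ⟩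
    F h (3 ℕ.+ n) ∎

  Finc-sum-recurrence : ∀ n l →
    sumTo (suc l) (Finc h (3 ℕ.+ n)) ≈ h * sumTo (suc l) (Finc h (2 ℕ.+ n)) + sumTo l (Finc h (suc n))
  Finc-sum-recurrence n l = sumTo-recurrence l h (summand-zero-recurrence (suc n)) (Finc-recurrence n)

  -- Σ_l F^l_n for n = 2k+1 and n = 2k+2, where the upper limit ⌊(n-1)/2⌋ is k.
  oddSum evenSum : ℕ → Carrier
  oddSum k = sumTo k (Finc h (suc (k ℕ.* 2)))
  evenSum k = sumTo k (Finc h (2 ℕ.+ k ℕ.* 2))

  oddSum-recurrence : ∀ k → oddSum (suc k) ≈ h * evenSum k + oddSum k + h * F h (2 ℕ.+ k ℕ.* 2)
  oddSum-recurrence k = begin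
    oddSum (suc k)
      ≈⟨ Finc-sum-recurrence (k ℕ.* 2) k ⟩
    h * (evenSum k + Finc h (2 ℕ.+ k ℕ.* 2) (suc k)) + oddSum k
      ≈⟨ +-congʳ (*-congˡ (+-congˡ (Finc-saturates (suc (k ℕ.* 2)) (suc k) (n≤1+n _)))) ⟩
    h * (evenSum k + F h (2 ℕ.+ k ℕ.* 2)) + oddSum k
      ≈⟨ solve 4 (λ h s f t → h :* (s :+ f) :+ t := h :* s :+ t :+ h :* f)
                 refl h (evenSum k) (F h (2 ℕ.+ k ℕ.* 2)) (oddSum k) ⟩
    h * evenSum k + oddSum k + h * F h (2 ℕ.+ k ℕ.* 2) ∎

  evenSum-recurrence : ∀ k → evenSum (suc k) ≈ h * oddSum (suc k) + evenSum k
  evenSum-recurrence k = Finc-sum-recurrence (suc (k ℕ.* 2)) k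

  Δ : Carrier
  Δ = pow h 2 + ι 4

  Δᴾ : ∀ {k} → Polynomial k → Polynomial k
  Δᴾ h = h :* (h :* con 1) :+ ιᴾ 4

  Δ*F[1+n]≈L[2+n]+L[n] : ∀ n → Δ * F h (suc n) ≈ L h (2 ℕ.+ n) + L h n
  Δ*F[1+n]≈L[2+n]+L[n] zero =
    solve 1 (λ h → Δᴾ h :* con 1 := (h :* h :+ (con 1 :+ con 1)) :+ (con 1 :+ con 1)) refl h
  Δ*F[1+n]≈L[2+n]+L[n] (suc zero) =
    solve 1 (λ h → Δᴾ h :* (h :* con 1 :+ con 0) := (h :* (h :* h :+ (con 1 :+ con 1)) :+ h) :+ h) refl h
  Δ*F[1+n]≈L[2+n]+L[n] (suc (suc n)) = begin
    Δ * (h * F h (2 ℕ.+ n) + F h (suc n))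
      ≈⟨ solve 4 (λ d h x y → d :* (h :* x :+ y) := h :* (d :* x) :+ d :* y)
                 refl Δ h (F h (2 ℕ.+ n)) (F h (suc n)) ⟩
    h * (Δ * F h (2 ℕ.+ n)) + Δ * F h (suc n)
      ≈⟨ +-cong (*-congˡ (Δ*F[1+n]≈L[2+n]+L[n] (suc n))) (Δ*F[1+n]≈L[2+n]+L[n] n) ⟩
    h * (L h (3 ℕ.+ n) + L h (suc n)) + (L h (2 ℕ.+ n) + L h n)
      ≈⟨ solve 5 (λ h a b c d → h :* (a :+ b) :+ (c :+ d) := (h :* a :+ c) :+ (h :* b :+ d))
                 refl h _ _ _ _ ⟩
    L h (4 ℕ.+ n) + L h (2 ℕ.+ n) ∎

  A : ℕ → Carrier
  A n = ι 4 * F h n + ι n * h * L h n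

  A-recurrence : ∀ n → A (2 ℕ.+ n) ≈ h * A (suc n) + A n + h * (Δ * F h (suc n))
  A-recurrence n = begin
    ι 4 * (h * F h (suc n) + F h n) + (1# + (1# + ι n)) * h * (h * L h (suc n) + L h n)
      ≈⟨ solve 6 (λ h f₁ f₀ l₁ l₀ m →
            ιᴾ 4 :* (h :* f₁ :+ f₀) :+ (con 1 :+ (con 1 :+ m)) :* h :* (h :* l₁ :+ l₀)
              := h :* (ιᴾ 4 :* f₁ :+ (con 1 :+ m) :* h :* l₁) :+ (ιᴾ 4 :* f₀ :+ m :* h :* l₀)
                   :+ h :* ((h :* l₁ :+ l₀) :+ l₀))
           refl h (F h (suc n)) (F h n) (L h (suc n)) (L h n) (ι n) ⟩
    h * A (suc n) + A n + h * (L h (2 ℕ.+ n) + L h n)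
      ≈˘⟨ +-congˡ (*-congˡ (Δ*F[1+n]≈L[2+n]+L[n] n)) ⟩
    h * A (suc n) + A n + h * (Δ * F h (suc n)) ∎

  odd-identity-step : ∀ n {s₂ s₁ s₀} → s₂ ≈ h * s₁ + s₀ + h * F h (suc n) →
    ι 2 * Δ * s₁ ≈ A (suc n) → ι 2 * Δ * s₀ ≈ A n + Δ * F h n →
    ι 2 * Δ * s₂ ≈ A (2 ℕ.+ n) + Δ * F h (2 ℕ.+ n)
  odd-identity-step n {s₂} {s₁} {s₀} s₂≈ s₁≈ s₀≈ = begin
    ι 2 * Δ * s₂
      ≈⟨ *-congˡ s₂≈ ⟩
    ι 2 * Δ * (h * s₁ + s₀ + h * F h (suc n))
      ≈⟨ solve 5 (λ d h x y f → ιᴾ 2 :* d :* (h :* x :+ y :+ h :* f)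
                   := h :* (ιᴾ 2 :* d :* x) :+ ιᴾ 2 :* d :* y :+ h :* (d :* f) :+ h :* (d :* f))
                 refl Δ h s₁ s₀ (F h (suc n)) ⟩
    h * (ι 2 * Δ * s₁) + ι 2 * Δ * s₀ + h * (Δ * F h (suc n)) + h * (Δ * F h (suc n))
      ≈⟨ +-congʳ (+-congʳ (+-cong (*-congˡ s₁≈) s₀≈)) ⟩
    h * A (suc n) + (A n + Δ * F h n) + h * (Δ * F h (suc n)) + h * (Δ * F h (suc n))
      ≈⟨ solve 6 (λ d h a₁ a₀ f₁ f₀ → h :* a₁ :+ (a₀ :+ d :* f₀) :+ h :* (d :* f₁) :+ h :* (d :* f₁)
                   := (h :* a₁ :+ a₀ :+ h :* (d :* f₁)) :+ d :* (h :* f₁ :+ f₀))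
                 refl Δ h (A (suc n)) (A n) (F h (suc n)) (F h n) ⟩
    (h * A (suc n) + A n + h * (Δ * F h (suc n))) + Δ * F h (2 ℕ.+ n)
      ≈˘⟨ +-congʳ (A-recurrence n) ⟩
    A (2 ℕ.+ n) + Δ * F h (2 ℕ.+ n) ∎

  even-identity-step : ∀ n {s₂ s₁ s₀} → s₂ ≈ h * s₁ + s₀ →
    ι 2 * Δ * s₁ ≈ A (suc n) + Δ * F h (suc n) → ι 2 * Δ * s₀ ≈ A n →
    ι 2 * Δ * s₂ ≈ A (2 ℕ.+ n)
  even-identity-step n {s₂} {s₁} {s₀} s₂≈ s₁≈ s₀≈ = begin
    ι 2 * Δ * s₂
      ≈⟨ *-congˡ s₂≈ ⟩
    ι 2 * Δ * (h * s₁ + s₀)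
      ≈⟨ solve 4 (λ k h x y → k :* (h :* x :+ y) := h :* (k :* x) :+ k :* y)
                 refl (ι 2 * Δ) h s₁ s₀ ⟩
    h * (ι 2 * Δ * s₁) + ι 2 * Δ * s₀
      ≈⟨ +-cong (*-congˡ s₁≈) s₀≈ ⟩
    h * (A (suc n) + Δ * F h (suc n)) + A n
      ≈⟨ solve 4 (λ h a b c → h :* (a :+ b) :+ c := h :* a :+ c :+ h :* b)
                 refl h (A (suc n)) (Δ * F h (suc n)) (A n) ⟩
    h * A (suc n) + A n + h * (Δ * F h (suc n))
      ≈˘⟨ A-recurrence n ⟩
    A (2 ℕ.+ n) ∎

  sum-identities : ∀ k → ι 2 * Δ * oddSum k ≈ A (suc (k ℕ.* 2)) + Δ * F h (suc (k ℕ.* 2))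
                       × ι 2 * Δ * evenSum k ≈ A (2 ℕ.+ k ℕ.* 2)
  sum-identities zero =
      solve 1 (λ h → ιᴾ 2 :* Δᴾ h :* ((con 1 :+ con 0) :* con 1)
                 := ιᴾ 4 :* con 1 :+ (con 1 :+ con 0) :* h :* h :+ Δᴾ h :* con 1) refl h
    , solve 1 (λ h → ιᴾ 2 :* Δᴾ h :* ((con 1 :+ con 0) :* (h :* con 1))
                 := ιᴾ 4 :* (h :* con 1 :+ con 0) :+ ιᴾ 2 :* h :* (h :* h :+ (con 1 :+ con 1))) refl h
  sum-identities (suc k) = odd , even-identity-step (2 ℕ.+ k ℕ.* 2) (evenSum-recurrence k) odd even
    where
    even : ι 2 * Δ * evenSum k ≈ A (2 ℕ.+ k ℕ.* 2)
    even = proj₂ (sum-identities k)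
    odd : ι 2 * Δ * oddSum (suc k) ≈ A (3 ℕ.+ k ℕ.* 2) + Δ * F h (3 ℕ.+ k ℕ.* 2)
    odd = odd-identity-step (suc (k ℕ.* 2)) (oddSum-recurrence k) even (proj₁ (sum-identities k))

  sumFinc : ℕ → Carrier
  sumFinc n = sumTo ⌊ n ∸ 1 /2⌋ (Finc h n)

  sumFinc-odd : ∀ k {d} → d * (ι 2 * Δ) ≈ 1# →
    let n = suc (k ℕ.* 2) in sumFinc n ≈ ((pow h 2 + ι 8) * F h n + ι n * h * L h n) * d
  sumFinc-odd k d*2Δ≈1 = solve-by-inverse d*2Δ≈1 (begin
    ι 2 * Δ * sumFinc n           ≡⟨ cong (λ m → ι 2 * Δ * sumTo m (Finc h n)) (⌊n*2/2⌋≡n k) ⟩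
    ι 2 * Δ * oddSum k            ≈⟨ proj₁ (sum-identities k) ⟩
    A n + Δ * F h n               ≈⟨ solve 4 (λ h f m l → ιᴾ 4 :* f :+ m :* h :* l :+ Δᴾ h :* f
                                                := (h :* (h :* con 1) :+ ιᴾ 8) :* f :+ m :* h :* l)
                                              refl h (F h n) (ι n) (L h n) ⟩
    (pow h 2 + ι 8) * F h n + ι n * h * L h n ∎)
    where
    n : ℕ
    n = suc (k ℕ.* 2)

  sumFinc-even : ∀ k {d} → d * (ι 2 * Δ) ≈ 1# → sumFinc (2 ℕ.+ k ℕ.* 2) ≈ A (2 ℕ.+ k ℕ.* 2) * d
  sumFinc-even k d*2Δ≈1 = solve-by-inverse d*2Δ≈1 (begin
    ι 2 * Δ * sumFinc n ≡⟨ cong (λ m → ι 2 * Δ * sumTo m (Finc h n)) (⌊1+n*2/2⌋≡n k) ⟩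
    ι 2 * Δ * evenSum k ≈⟨ proj₂ (sum-identities k) ⟩
    A n                 ∎)
    where
    n : ℕ
    n = 2 ℕ.+ k ℕ.* 2

proposition7 : ∀ {c ℓ} (R : CommutativeRing c ℓ) →
    let open CommutativeRing R
        open HFib R
    in (h : Carrier) (n : ℕ) → 1 ℕ.≤ n →
       (d : Carrier) → d * (ι 2 * (pow h 2 + ι 4)) ≈ 1# →
       (n % 2 ≡ 0 →
          sumTo ⌊ n ∸ 1 /2⌋ (Finc h n)
            ≈ (ι 4 * F h n + ι n * h * L h n) * d)
       × (n % 2 ≡ 1 →
          sumTo ⌊ n ∸ 1 /2⌋ (Finc h n)
            ≈ ((pow h 2 + ι 8) * F h n + ι n * h * L h n) * d)
proposition7 R h (suc m) _ d d*2Δ≈1 with even-or-odd m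
... | inj₁ (k , ≡.refl) =
    (λ odd≡0 → ⊥-elim (1+n≢0 (≡.trans (≡.sym ([1+n*2]%2≡1 k)) odd≡0)))
  , (λ _ → IncompleteFibonacciSums.sumFinc-odd R h k d*2Δ≈1)
... | inj₂ (k , ≡.refl) =
    (λ _ → IncompleteFibonacciSums.sumFinc-even R h k d*2Δ≈1)
  , (λ even≡1 → ⊥-elim (0≢1+n (≡.trans (≡.sym ([2+n*2]%2≡0 k)) even≡1)))
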